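{- Let $G$ be a finite abelian group of order $n$ such that the generalized dihedral group $D(G)$ is non-abelian, and let $r\ge0$ satisfy $2^r=|\{g\in G:g^2=e\}|$. Then the commuting graph $\Gamma=\mathfrak{C}(D(G),D(G))$ has \[|E(\Gamma)|=3n2^{r-1}+\frac{n(n-2)}{2}.\]
   Context: $D(G)=G\rtimes C_2$, $C_2=\{1,-1\}$, has elements $(g,c)$ with multiplication $(g_1,c_1)(g_2,c_2)=(g_1g_2^{c_1},c_1c_2)$. The commuting graph $\mathfrak{C}(D(G),D(G))$ is the simple graph with vertex set $D(G)$ in which distinct $u,v$ are adjacent iff $uv=vu$; $E(\Gamma)$ is its edge set. -}

module Defs where

open import Data.Nat using (ℕ)
open import Data.Fin using (Fin)
open import Data.Fin.Properties using () renaming (_≟_ to _≟F_)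
open import Data.Bool using (Bool; true; false)
open import Data.Bool.Properties using () renaming (_≟_ to _≟B_)
open import Data.Product using (_×_; _,_)
open import Data.Product.Properties using (≡-dec)
open import Data.List using (List; []; _∷_; map; _++_; filter; length; allFin; cartesianProduct)
open import Relation.Binary.PropositionalEquality using (_≡_)
open import Relation.Binary.Definitions using (DecidableEquality)
open import Algebra.Structures using (IsAbelianGroup)

-- A finite abelian group of order n, presented on the carrier Fin n
-- (every finite abelian group of order n is isomorphic to one of these).
record FinAbGroup (n : ℕ) : Set where
  field
    _∙_ : Fin n → Fin n → Fin n
    ε   : Fin n
    _⁻¹ : Fin n → Fin n
    isAbelianGroup : IsAbelianGroup _≡_ _∙_ ε _⁻¹

module _ {n : ℕ} (G : FinAbGroup n) where
  open FinAbGroup G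

  -- C₂ = {1, -1} encoded as Bool: true = 1, false = -1.
  -- Elements of D(G) = G ⋊ C₂.
  D : Set
  D = Fin n × Bool

  pow : Fin n → Bool → Fin n
  pow g true  = g
  pow g false = g ⁻¹

  mulC : Bool → Bool → Bool
  mulC true  c = c
  mulC false true = false
  mulC false false = true

  mulD : D → D → D
  mulD (g₁ , c₁) (g₂ , c₂) = (g₁ ∙ pow g₂ c₁) , mulC c₁ c₂

  _≟D_ : DecidableEquality D
  _≟D_ = ≡-dec _≟F_ _≟B_

  IsAbelianD : Set
  IsAbelianD = ∀ u v → mulD u v ≡ mulD v u

  elementsD : List D
  elementsD = cartesianProduct (allFin n) (true ∷ false ∷ [])

  pairs : {A : Set} → List A → List (A × A)
  pairs [] = []
  pairs (x ∷ xs) = map (x ,_) xs ++ pairs xs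


  edgeCount : ℕ
  edgeCount = length (filter (λ p → mulD (Data.Product.proj₁ p) (Data.Product.proj₂ p) ≟D mulD (Data.Product.proj₂ p) (Data.Product.proj₁ p)) (pairs elementsD))

  involutionCount : ℕ
  involutionCount = length (filter (λ g → (g ∙ g) ≟F ε) (allFin n))

module Submission where

-- 1. For any symmetric 0/1 weight w on a list xs of distinct vertices,
--      2 · Σ_{unordered pairs} w + Σ_x w x x = Σ_x Σ_y w x y.
--    With w = "commutes", the left side is 2|E| + |D(G)| = 2|E| + 2n.
-- 2. Writing rotations as (g,1) and reflections as (g,-1):
--      rotations always commute with each other;
--      (g,1) commutes with (h,-1)  iff  g² = e;
--      (g,-1) commutes with (h,-1) iff  (g h⁻¹)² = e.
-- 3. Since h ↦ g h⁻¹ permutes G, each reflection commutes with exactly 2I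
--    elements and each rotation (g,1) with n(1 + [g² = e]) elements, so the
--    number of ordered commuting pairs is n² + 3nI.
-- Hence 2|E| = n² + 3nI − 2n, which is the corollary with I = 2^r.

open import Defs
open import Data.Nat using (ℕ; _^_; zero; suc) renaming (_+_ to _+ℕ_; _*_ to _*ℕ_)
open import Data.Integer using (ℤ; +_; _+_; _-_; _*_)
open import Relation.Binary.PropositionalEquality using (_≡_; refl; sym; trans; cong; cong₂; module ≡-Reasoning)
open import Relation.Nullary using (¬_; Dec; yes; no; does)

open import Data.Nat.Properties using (+-assoc; *-comm; *-distribˡ-+; *-zeroʳ; *-identityʳ; +-identityʳ; +-0-commutativeMonoid)
import Data.Nat.Tactic.RingSolver as ℕ-Solver
open import Data.Integer.Properties using (pos-+; pos-*)
import Data.Integer.Tactic.RingSolver as ℤ-Solver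
open import Data.Fin using (Fin)
open import Data.Fin.Properties using () renaming (_≟_ to _≟F_)
open import Data.Fin.Permutation using (Permutation′; permutation; _⟨$⟩ʳ_)
open import Data.Bool using (Bool; true; false; if_then_else_)
open import Data.Product using (_×_; _,_; proj₁; proj₂)
open import Data.Product.Properties using (,-injectiveˡ)
open import Data.List using (List; []; _∷_; map; _++_; filter; length; allFin; cartesianProduct; tabulate)
open import Data.List.Properties using (length-tabulate)
open import Algebra.Bundles using (AbelianGroup)
open import Algebra.Properties.CommutativeMonoid.Sum +-0-commutativeMonoid using (sum-permute) renaming (sum to ∑)
import Algebra.Properties.AbelianGroup as AbelianGroupProperties
open import Function using (_∘_; id; _⇔_; mk⇔; module Equivalence)
import Function.Properties.Equivalence as ⇔
open import Relation.Unary using (Pred; Decidable)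
open import Level using (0ℓ)

𝟙 : {A : Set} → Dec A → ℕ
𝟙 d = if does d then 1 else 0

𝟙-cong : {A B : Set} → A ⇔ B → (a : Dec A) (b : Dec B) → 𝟙 a ≡ 𝟙 b
𝟙-cong A⇔B (yes a) (yes b) = refl
𝟙-cong A⇔B (yes a) (no ¬b) with () ← ¬b (Equivalence.to A⇔B a)
𝟙-cong A⇔B (no ¬a) (yes b) with () ← ¬a (Equivalence.from A⇔B b)
𝟙-cong A⇔B (no ¬a) (no ¬b) = refl

𝟙-true : {A : Set} → A → (a : Dec A) → 𝟙 a ≡ 1
𝟙-true x (yes _) = refl
𝟙-true x (no ¬x) with () ← ¬x x

sumOver : {A : Set} → List A → (A → ℕ) → ℕ
sumOver []       f = 0
sumOver (x ∷ xs) f = f x +ℕ sumOver xs f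

length-filter≡sum𝟙 : {A : Set} {P : Pred A 0ℓ} (P? : Decidable P) (xs : List A) →
  length (filter P? xs) ≡ sumOver xs (λ x → 𝟙 (P? x))
length-filter≡sum𝟙 P? [] = refl
length-filter≡sum𝟙 P? (x ∷ xs) with does (P? x)
... | true  = cong suc (length-filter≡sum𝟙 P? xs)
... | false = length-filter≡sum𝟙 P? xs

sumOver-++ : {A : Set} (xs ys : List A) (f : A → ℕ) →
  sumOver (xs ++ ys) f ≡ sumOver xs f +ℕ sumOver ys f
sumOver-++ []       ys f = refl
sumOver-++ (x ∷ xs) ys f = trans (cong (f x +ℕ_) (sumOver-++ xs ys f)) (sym (+-assoc (f x) _ _))

sumOver-map : {A B : Set} (g : A → B) (xs : List A) (f : B → ℕ) →
  sumOver (map g xs) f ≡ sumOver xs (f ∘ g)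
sumOver-map g []       f = refl
sumOver-map g (x ∷ xs) f = cong (f (g x) +ℕ_) (sumOver-map g xs f)

sumOver-cong : {A : Set} (xs : List A) {f g : A → ℕ} → (∀ x → f x ≡ g x) →
  sumOver xs f ≡ sumOver xs g
sumOver-cong []       f≗g = refl
sumOver-cong (x ∷ xs) f≗g = cong₂ _+ℕ_ (f≗g x) (sumOver-cong xs f≗g)

sumOver-+ : {A : Set} (xs : List A) (f g : A → ℕ) →
  sumOver xs (λ x → f x +ℕ g x) ≡ sumOver xs f +ℕ sumOver xs g
sumOver-+ []       f g = refl
sumOver-+ (x ∷ xs) f g =
  trans (cong (f x +ℕ g x +ℕ_) (sumOver-+ xs f g)) (interchange (f x) (g x) _ _)
  where
  interchange : ∀ a b c d → (a +ℕ b) +ℕ (c +ℕ d) ≡ (a +ℕ c) +ℕ (b +ℕ d)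
  interchange = ℕ-Solver.solve-∀

sumOver-scale : {A : Set} (xs : List A) (k : ℕ) (f : A → ℕ) →
  sumOver xs (λ x → k *ℕ f x) ≡ k *ℕ sumOver xs f
sumOver-scale []       k f = sym (*-zeroʳ k)
sumOver-scale (x ∷ xs) k f =
  trans (cong (k *ℕ f x +ℕ_) (sumOver-scale xs k f)) (sym (*-distribˡ-+ k (f x) _))

sumOver-const : {A : Set} (xs : List A) (k : ℕ) → sumOver xs (λ _ → k) ≡ length xs *ℕ k
sumOver-const []       k = refl
sumOver-const (x ∷ xs) k = cong (k +ℕ_) (sumOver-const xs k)

sumOver-cartesianProduct : {A B : Set} (xs : List A) (ys : List B) (f : A × B → ℕ) →
  sumOver (cartesianProduct xs ys) f ≡ sumOver xs (λ x → sumOver ys (λ y → f (x , y)))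
sumOver-cartesianProduct []       ys f = refl
sumOver-cartesianProduct (x ∷ xs) ys f =
  trans (sumOver-++ (map (x ,_) ys) _ f)
        (cong₂ _+ℕ_ (sumOver-map (x ,_) ys f) (sumOver-cartesianProduct xs ys f))

sumOver-allFin-permute : {n : ℕ} (f : Fin n → ℕ) (π : Permutation′ n) →
  sumOver (allFin n) (λ i → f (π ⟨$⟩ʳ i)) ≡ sumOver (allFin n) f
sumOver-allFin-permute f π =
  trans (asFinSum (λ i → f (π ⟨$⟩ʳ i))) (trans (sym (sum-permute f π)) (sym (asFinSum f)))
  where
  asTabulatedSum : ∀ {m} {A : Set} (h : Fin m → A) (g : A → ℕ) →
    sumOver (tabulate h) g ≡ ∑ (g ∘ h)
  asTabulatedSum {zero}  h g = refl
  asTabulatedSum {suc m} h g = cong (g (h Fin.zero) +ℕ_) (asTabulatedSum (h ∘ Fin.suc) g)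
  asFinSum : (g : Fin _ → ℕ) → sumOver (allFin _) g ≡ ∑ g
  asFinSum g = asTabulatedSum id g

-- Double counting: for a symmetric weight, every unordered pair of distinct
-- positions is counted twice among the ordered pairs, the diagonal once.
module _ {m : ℕ} (H : FinAbGroup m) {A : Set} (w : A → A → ℕ)
         (w-sym : ∀ x y → w x y ≡ w y x) where

  -- 'pairs' is declared in Defs inside a group's module but does not use it.
  2·pairs+diagonal : (xs : List A) →
    2 *ℕ sumOver (pairs H xs) (λ p → w (proj₁ p) (proj₂ p)) +ℕ sumOver xs (λ x → w x x)
      ≡ sumOver xs (λ x → sumOver xs (w x))
  2·pairs+diagonal [] = refl
  2·pairs+diagonal (x ∷ xs) = begin
      2 *ℕ sumOver (map (x ,_) xs ++ pairs H xs) wᵖ +ℕ (w x x +ℕ diagonal)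
    ≡⟨ cong (λ s → 2 *ℕ s +ℕ (w x x +ℕ diagonal))
            (trans (sumOver-++ (map (x ,_) xs) _ wᵖ) (cong (_+ℕ P) (sumOver-map (x ,_) xs wᵖ))) ⟩
      2 *ℕ (row +ℕ P) +ℕ (w x x +ℕ diagonal)
    ≡⟨ rearrange row P diagonal (w x x) ⟩
      (w x x +ℕ row) +ℕ (row +ℕ (2 *ℕ P +ℕ diagonal))
    ≡⟨ cong₂ (λ s t → (w x x +ℕ row) +ℕ (s +ℕ t)) (sumOver-cong xs (w-sym x)) (2·pairs+diagonal xs) ⟩
      (w x x +ℕ row) +ℕ (sumOver xs (λ y → w y x) +ℕ sumOver xs (λ y → sumOver xs (w y)))
    ≡⟨ cong ((w x x +ℕ row) +ℕ_) (sym (sumOver-+ xs (λ y → w y x) (λ y → sumOver xs (w y)))) ⟩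
      (w x x +ℕ row) +ℕ sumOver xs (λ y → w y x +ℕ sumOver xs (w y))
    ∎
    where
    open ≡-Reasoning
    wᵖ : A × A → ℕ
    wᵖ p = w (proj₁ p) (proj₂ p)
    row P diagonal : ℕ
    row      = sumOver xs (w x)
    P        = sumOver (pairs H xs) wᵖ
    diagonal = sumOver xs (λ y → w y y)
    rearrange : ∀ a p d c → 2 *ℕ (a +ℕ p) +ℕ (c +ℕ d) ≡ (c +ℕ a) +ℕ (a +ℕ (2 *ℕ p +ℕ d))
    rearrange = ℕ-Solver.solve-∀

module _ {n : ℕ} (G : FinAbGroup n) where
  open FinAbGroup G

  asAbelianGroup : AbelianGroup 0ℓ 0ℓ
  asAbelianGroup = record { isAbelianGroup = isAbelianGroup }

  open AbelianGroup asAbelianGroup renaming (_-_ to _÷_) using (comm; assoc; inverseʳ; identityˡ)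
  open AbelianGroupProperties asAbelianGroup using (inverseˡ-unique; ∙-cancelʳ; ⁻¹-anti-homo‿-)

  commutes : D G → D G → ℕ
  commutes u v = 𝟙 (_≟D_ G (mulD G u v) (mulD G v u))

  commutes-sym : ∀ u v → commutes u v ≡ commutes v u
  commutes-sym u v = 𝟙-cong (mk⇔ sym sym) (_≟D_ G (mulD G u v) (mulD G v u)) (_≟D_ G (mulD G v u) (mulD G u v))

  isInvolution : Fin n → ℕ
  isInvolution g = 𝟙 (g ∙ g ≟F ε)

  involutions : ℕ
  involutions = sumOver (allFin n) isInvolution

  involutionCount≡involutions : involutionCount G ≡ involutions
  involutionCount≡involutions = length-filter≡sum𝟙 _ (allFin n)

  selfInverse⇔square≡ε : ∀ x → (x ≡ x ⁻¹) ⇔ (x ∙ x ≡ ε)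
  selfInverse⇔square≡ε x =
    mk⇔ (λ x≡x⁻¹ → trans (cong (x ∙_) x≡x⁻¹) (inverseʳ x)) (inverseˡ-unique x x)

  sameSign-viaSelfInverse : ∀ {c : Bool} {a b : Fin n} (x : Fin n) →
    (a ≡ b) ⇔ (x ≡ x ⁻¹) → (uv≟vu : Dec ((a , c) ≡ (b , c))) → 𝟙 uv≟vu ≡ isInvolution x
  sameSign-viaSelfInverse x a≡b⇔selfInverse uv≟vu =
    𝟙-cong (⇔.trans (mk⇔ ,-injectiveˡ (cong (_, _))) (⇔.trans a≡b⇔selfInverse (selfInverse⇔square≡ε x)))
           uv≟vu (x ∙ x ≟F ε)

  rotation-rotation : ∀ g h → commutes (g , true) (h , true) ≡ 1
  rotation-rotation g h = 𝟙-true (cong (_, true) (comm g h)) (_≟D_ G _ _)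

  -- (g,1)(h,-1) = (gh,-1) and (h,-1)(g,1) = (hg⁻¹,-1) = (g⁻¹h,-1).
  rotation-reflection : ∀ g h → commutes (g , true) (h , false) ≡ isInvolution g
  rotation-reflection g h = sameSign-viaSelfInverse g
    (mk⇔ (λ gh≡hg⁻¹ → ∙-cancelʳ h g (g ⁻¹) (trans gh≡hg⁻¹ (comm h (g ⁻¹))))
         (λ g≡g⁻¹ → trans (cong (_∙ h) g≡g⁻¹) (comm (g ⁻¹) h)))
    (_≟D_ G _ _)

  -- (g,-1)(h,-1) = (gh⁻¹,1) and (h,-1)(g,-1) = (hg⁻¹,1) = ((gh⁻¹)⁻¹,1).
  reflection-reflection : ∀ g h → commutes (g , false) (h , false) ≡ isInvolution (g ÷ h)
  reflection-reflection g h = sameSign-viaSelfInverse (g ÷ h)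
    (mk⇔ (λ x≡hg⁻¹ → trans x≡hg⁻¹ (sym (⁻¹-anti-homo‿- g h))) (λ x≡x⁻¹ → trans x≡x⁻¹ (⁻¹-anti-homo‿- g h)))
    (_≟D_ G _ _)

  reflect : Fin n → Permutation′ n
  reflect g = permutation (g ÷_) (g ÷_) (twice g) (twice g)
    where
    open ≡-Reasoning
    twice : ∀ g y → g ÷ (g ÷ y) ≡ y
    twice g y = begin
      g ÷ (g ÷ y)       ≡⟨ cong (g ∙_) (⁻¹-anti-homo‿- g y) ⟩
      g ∙ (y ∙ (g ⁻¹))  ≡⟨ cong (g ∙_) (comm y (g ⁻¹)) ⟩
      g ∙ ((g ⁻¹) ∙ y)  ≡⟨ sym (assoc g (g ⁻¹) y) ⟩
      (g ∙ (g ⁻¹)) ∙ y  ≡⟨ cong (_∙ y) (inverseʳ g) ⟩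
      ε ∙ y             ≡⟨ identityˡ y ⟩
      y                 ∎

  |G| : length (allFin n) ≡ n
  |G| = length-tabulate id

  sumOver-D : (f : D G → ℕ) →
    sumOver (elementsD G) f ≡ sumOver (allFin n) (λ g → f (g , true) +ℕ f (g , false))
  sumOver-D f = trans (sumOver-cartesianProduct (allFin n) (true ∷ false ∷ []) f)
    (sumOver-cong (allFin n) (λ g → cong (f (g , true) +ℕ_) (+-identityʳ (f (g , false)))))

  rotationDegree : ∀ g → sumOver (elementsD G) (commutes (g , true)) ≡ n *ℕ (1 +ℕ isInvolution g)
  rotationDegree g = begin
    sumOver (elementsD G) (commutes (g , true))
      ≡⟨ sumOver-D (commutes (g , true)) ⟩
    sumOver (allFin n) (λ h → commutes (g , true) (h , true) +ℕ commutes (g , true) (h , false))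
      ≡⟨ sumOver-cong (allFin n) (λ h → cong₂ _+ℕ_ (rotation-rotation g h) (rotation-reflection g h)) ⟩
    sumOver (allFin n) (λ _ → 1 +ℕ isInvolution g)
      ≡⟨ sumOver-const (allFin n) _ ⟩
    length (allFin n) *ℕ (1 +ℕ isInvolution g)
      ≡⟨ cong (_*ℕ (1 +ℕ isInvolution g)) |G| ⟩
    n *ℕ (1 +ℕ isInvolution g) ∎
    where open ≡-Reasoning

  -- A reflection (g,-1) commutes with I rotations and, since h ↦ g h⁻¹
  -- permutes G, with I reflections.
  reflectionDegree : ∀ g → sumOver (elementsD G) (commutes (g , false)) ≡ involutions +ℕ involutions
  reflectionDegree g = begin
    sumOver (elementsD G) (commutes (g , false))
      ≡⟨ sumOver-D (commutes (g , false)) ⟩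
    sumOver (allFin n) (λ h → commutes (g , false) (h , true) +ℕ commutes (g , false) (h , false))
      ≡⟨ sumOver-cong (allFin n) (λ h → cong₂ _+ℕ_
           (trans (commutes-sym (g , false) (h , true)) (rotation-reflection h g))
           (reflection-reflection g h)) ⟩
    sumOver (allFin n) (λ h → isInvolution h +ℕ isInvolution (g ÷ h))
      ≡⟨ sumOver-+ (allFin n) isInvolution (λ h → isInvolution (g ÷ h)) ⟩
    involutions +ℕ sumOver (allFin n) (λ h → isInvolution (g ÷ h))
      ≡⟨ cong (involutions +ℕ_) (sumOver-allFin-permute isInvolution (reflect g)) ⟩
    involutions +ℕ involutions ∎
    where open ≡-Reasoning

  orderedCommutingPairs :
    sumOver (elementsD G) (λ u → sumOver (elementsD G) (commutes u)) ≡ n *ℕ n +ℕ 3 *ℕ n *ℕ involutions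
  orderedCommutingPairs = begin
    sumOver (elementsD G) (λ u → sumOver (elementsD G) (commutes u))
      ≡⟨ sumOver-D _ ⟩
    sumOver (allFin n) (λ g → sumOver (elementsD G) (commutes (g , true)) +ℕ sumOver (elementsD G) (commutes (g , false)))
      ≡⟨ sumOver-cong (allFin n) (λ g → cong₂ _+ℕ_ (rotationDegree g) (reflectionDegree g)) ⟩
    sumOver (allFin n) (λ g → n *ℕ (1 +ℕ isInvolution g) +ℕ (I +ℕ I))
      ≡⟨ sumOver-+ (allFin n) _ _ ⟩
    sumOver (allFin n) (λ g → n *ℕ (1 +ℕ isInvolution g)) +ℕ sumOver (allFin n) (λ _ → I +ℕ I)
      ≡⟨ cong₂ _+ℕ_ (sumOver-scale (allFin n) n _) (sumOver-const (allFin n) _) ⟩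
    n *ℕ sumOver (allFin n) (λ g → 1 +ℕ isInvolution g) +ℕ length (allFin n) *ℕ (I +ℕ I)
      ≡⟨ cong₂ (λ s k → n *ℕ s +ℕ k *ℕ (I +ℕ I)) rotationsCount |G| ⟩
    n *ℕ (n +ℕ I) +ℕ n *ℕ (I +ℕ I)
      ≡⟨ collect n I ⟩
    n *ℕ n +ℕ 3 *ℕ n *ℕ I ∎
    where
    open ≡-Reasoning
    I : ℕ
    I = involutions
    rotationsCount : sumOver (allFin n) (λ g → 1 +ℕ isInvolution g) ≡ n +ℕ I
    rotationsCount = trans (sumOver-+ (allFin n) (λ _ → 1) isInvolution)
      (cong (_+ℕ I) (trans (sumOver-const (allFin n) 1) (trans (*-identityʳ _) |G|)))
    collect : ∀ n I → n *ℕ (n +ℕ I) +ℕ n *ℕ (I +ℕ I) ≡ n *ℕ n +ℕ 3 *ℕ n *ℕ I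
    collect = ℕ-Solver.solve-∀

  2·edges+2n : 2 *ℕ edgeCount G +ℕ 2 *ℕ n ≡ n *ℕ n +ℕ 3 *ℕ n *ℕ involutions
  2·edges+2n = begin
    2 *ℕ edgeCount G +ℕ 2 *ℕ n
      ≡⟨ cong₂ (λ e d → 2 *ℕ e +ℕ d) (length-filter≡sum𝟙 _ (pairs G (elementsD G))) (sym diagonal) ⟩
    2 *ℕ sumOver (pairs G (elementsD G)) (λ p → commutes (proj₁ p) (proj₂ p)) +ℕ sumOver (elementsD G) (λ u → commutes u u)
      ≡⟨ 2·pairs+diagonal G commutes commutes-sym (elementsD G) ⟩
    sumOver (elementsD G) (λ u → sumOver (elementsD G) (commutes u))
      ≡⟨ orderedCommutingPairs ⟩
    n *ℕ n +ℕ 3 *ℕ n *ℕ involutions ∎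
    where
    open ≡-Reasoning
    diagonal : sumOver (elementsD G) (λ u → commutes u u) ≡ 2 *ℕ n
    diagonal = begin
      sumOver (elementsD G) (λ u → commutes u u)
        ≡⟨ sumOver-D (λ u → commutes u u) ⟩
      sumOver (allFin n) (λ g → commutes (g , true) (g , true) +ℕ commutes (g , false) (g , false))
        ≡⟨ sumOver-cong (allFin n) (λ g → cong₂ _+ℕ_ (commutes-refl (g , true)) (commutes-refl (g , false))) ⟩
      sumOver (allFin n) (λ _ → 2)
        ≡⟨ sumOver-const (allFin n) 2 ⟩
      length (allFin n) *ℕ 2
        ≡⟨ cong (_*ℕ 2) |G| ⟩
      n *ℕ 2
        ≡⟨ *-comm n 2 ⟩
      2 *ℕ n ∎
      where
      commutes-refl : ∀ u → commutes u u ≡ 1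
      commutes-refl u = 𝟙-true refl (_≟D_ G (mulD G u u) (mulD G u u))

-- Reading 2E + 2n = n² + 3nI in ℤ, where n − 2 may be negative.
doubledEdges-inℤ : (E n I : ℕ) → 2 *ℕ E +ℕ 2 *ℕ n ≡ n *ℕ n +ℕ 3 *ℕ n *ℕ I →
  + 2 * + E ≡ + 3 * + n * + I + + n * (+ n - + 2)
doubledEdges-inℤ E n I 2E+2n≡ = begin
  + 2 * + E                                    ≡⟨ addSubtract (+ 2 * + E) (+ 2 * + n) ⟩
  (+ 2 * + E + + 2 * + n) - + 2 * + n          ≡⟨ cong (_- + 2 * + n) (sym lhsCast) ⟩
  + (2 *ℕ E +ℕ 2 *ℕ n) - + 2 * + n             ≡⟨ cong (λ k → + k - + 2 * + n) 2E+2n≡ ⟩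
  + (n *ℕ n +ℕ 3 *ℕ n *ℕ I) - + 2 * + n        ≡⟨ cong (_- + 2 * + n) rhsCast ⟩
  (+ n * + n + + 3 * + n * + I) - + 2 * + n    ≡⟨ regroup (+ n) (+ I) ⟩
  + 3 * + n * + I + + n * (+ n - + 2)          ∎
  where
  open ≡-Reasoning
  addSubtract : ∀ (x y : ℤ) → x ≡ (x + y) - y
  addSubtract = ℤ-Solver.solve-∀
  regroup : ∀ (n I : ℤ) → (n * n + + 3 * n * I) - + 2 * n ≡ + 3 * n * I + n * (n - + 2)
  regroup = ℤ-Solver.solve-∀
  lhsCast : + (2 *ℕ E +ℕ 2 *ℕ n) ≡ + 2 * + E + + 2 * + n
  lhsCast = trans (pos-+ (2 *ℕ E) (2 *ℕ n)) (cong₂ _+_ (pos-* 2 E) (pos-* 2 n))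
  rhsCast : + (n *ℕ n +ℕ 3 *ℕ n *ℕ I) ≡ + n * + n + + 3 * + n * + I
  rhsCast = trans (pos-+ (n *ℕ n) (3 *ℕ n *ℕ I))
    (cong₂ _+_ (pos-* n n) (trans (pos-* (3 *ℕ n) I) (cong (_* + I) (pos-* 3 n))))

corollary2p4 : (n : ℕ) (G : FinAbGroup n) → ¬ IsAbelianD G → (r : ℕ) →
    2 Data.Nat.^ r ≡ involutionCount G →
    + 2 * + edgeCount G ≡ + 3 * + n * + (2 Data.Nat.^ r) + + n * (+ n - + 2)
corollary2p4 n G _ r 2^r≡I =
  doubledEdges-inℤ (edgeCount G) n (2 ^ r)
    (trans (2·edges+2n G)
           (cong (λ I → n *ℕ n +ℕ 3 *ℕ n *ℕ I) (sym (trans 2^r≡I (involutionCount≡involutions G)))))
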